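{- Let $G=G_{n,m}$ be the $n\times m$ grid graph and let $S$ be a connected dominating set of $G$. Let $l$ be the number of vertices of degree $1$ in the induced subgraph $G[S]$, and let $d_3$ and $d_4$ be the numbers of vertices of degree $3$ and degree $4$ in $G[S]$, respectively. Then $l \leq d_3+2d_4+2$.
   Context: The grid graph $G_{n,m}$ has vertex set $\{1,\dots,n\}\times\{1,\dots,m\}$, with $(i_1,j_1)$ and $(i_2,j_2)$ adjacent iff $|i_1-i_2|+|j_1-j_2|=1$. A connected dominating set of a graph $G=(V,E)$ is a set $S \subseteq V$ such that $G[S]$ is connected and every vertex of $V$ is in $S$ or adjacent to a vertex of $S$. -}

module Defs where

open import Data.Nat using (ℕ; _+_; _*_; ∣_-_∣; _≡ᵇ_)
open import Data.Fin using (Fin; toℕ)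
open import Data.Bool using (Bool; true; false; _∧_; T)
open import Data.Product using (Σ; _×_; _,_; proj₁; proj₂)
open import Data.Sum using (_⊎_)
open import Data.List using (List; length; filter; allFin; cartesianProduct)
open import Relation.Binary.PropositionalEquality using (_≡_)
open import Relation.Nullary.Decidable using (Dec)
open import Data.Bool.Properties using (T?)

Vertex : ℕ → ℕ → Set
Vertex n m = Fin n × Fin m

dist : ∀ {n m} → Vertex n m → Vertex n m → ℕ
dist (i₁ , j₁) (i₂ , j₂) = ∣ toℕ i₁ - toℕ i₂ ∣ + ∣ toℕ j₁ - toℕ j₂ ∣

Adj : ∀ {n m} → Vertex n m → Vertex n m → Set
Adj u v = dist u v ≡ 1

adj? : ∀ {n m} → Vertex n m → Vertex n m → Bool
adj? u v = dist u v ≡ᵇ 1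

VSet : ℕ → ℕ → Set
VSet n m = Vertex n m → Bool

_∈S_ : ∀ {n m} → Vertex n m → VSet n m → Set
v ∈S S = T (S v)

vertices : ∀ n m → List (Vertex n m)
vertices n m = cartesianProduct (allFin n) (allFin m)

data WalkIn {n m} (S : VSet n m) : Vertex n m → Vertex n m → Set where
  here : ∀ {u} → u ∈S S → WalkIn S u u
  step : ∀ {u w v} → u ∈S S → Adj u w → WalkIn S w v → WalkIn S u v

Connected : ∀ {n m} → VSet n m → Set
Connected {n} {m} S = ∀ (u v : Vertex n m) → u ∈S S → v ∈S S → WalkIn S u v

Dominating : ∀ {n m} → VSet n m → Set
Dominating {n} {m} S =
  ∀ (v : Vertex n m) → (v ∈S S) ⊎ Σ (Vertex n m) (λ w → (w ∈S S) × Adj v w)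

ConnectedDominatingSet : ∀ {n m} → VSet n m → Set
ConnectedDominatingSet S = Connected S × Dominating S

degIn : ∀ {n m} → VSet n m → Vertex n m → ℕ
degIn {n} {m} S v = length (filter (λ w → T? (S w ∧ adj? v w)) (vertices n m))

countDeg : ∀ {n m} → VSet n m → ℕ → ℕ
countDeg {n} {m} S k = length (filter (λ v → T? (S v ∧ (degIn S v ≡ᵇ k))) (vertices n m))

-- The sum of the degrees in G[S] is twice its number of edges, and a connected graph on |S|
-- vertices has at least |S| - 1 edges (grow S from one vertex, adding a neighbour at a time;
-- each addition contributes a new edge), so  Σ_{v ∈ S} deg v ≥ 2|S| - 2.  In the grid every
-- degree is at most 4, and for d ≤ 4 we have  [d = 1] + d ≤ 2 + [d = 3] + 2[d = 4];  summing
-- over S and subtracting the degree sum gives  l ≤ d₃ + 2d₄ + 2.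
module Submission where

open import Defs
open import Data.Nat using (ℕ; zero; suc; _+_; _*_; _∸_; _≤_; _<_; z≤n; s≤s; s≤s⁻¹; _≡ᵇ_; ∣_-_∣)
import Data.Nat as ℕ
open import Data.Nat.Properties
open import Data.Nat.Tactic.RingSolver using (solve-∀)
open import Data.Fin using (toℕ)
import Data.Fin as Fin
open import Data.Fin.Properties using (toℕ-injective)
open import Data.Bool using (Bool; true; false; _∧_; _∨_; not)
import Data.Bool as Bool
open import Data.Bool.Properties using (T?; T-≡; ∨-zeroʳ; ¬-not)
open import Data.Product using (Σ; _×_; _,_; proj₁; proj₂)
open import Data.Product.Properties using (≡-dec)
open import Data.Sum using (_⊎_; inj₁; inj₂)
open import Data.List using (List; []; _∷_; length; filter)
open import Data.List.Membership.Propositional using (_∈_; lose)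
open import Data.List.Membership.Propositional.Properties using (∈-cartesianProduct⁺; ∈-allFin)
open import Data.List.Relation.Unary.Any using (here; there; any?; satisfied)
open import Data.List.Relation.Unary.All as All using (All)
open import Data.List.Relation.Unary.AllPairs using ([]; _∷_)
open import Data.List.Relation.Unary.Unique.Propositional using (Unique)
open import Data.List.Relation.Unary.Unique.Propositional.Properties using (cartesianProduct⁺; allFin⁺)
open import Function using (Equivalence)
open import Function.Definitions using (Injective)
open import Relation.Binary.Definitions using (DecidableEquality)
open import Relation.Binary.PropositionalEquality
open import Relation.Nullary using (yes; no; does)
open import Relation.Nullary.Decidable using (dec-true; dec-false)

⟦_⟧ : Bool → ℕ
⟦ true ⟧ = 1
⟦ false ⟧ = 0

⟦⟧-mono : ∀ {a b} → (a ≡ true → b ≡ true) → ⟦ a ⟧ ≤ ⟦ b ⟧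
⟦⟧-mono {false} _ = z≤n
⟦⟧-mono {true} a⇒b rewrite a⇒b refl = ≤-refl

⟦∧⟧-monoˡ : ∀ {a b} c → (a ≡ true → b ≡ true) → ⟦ a ∧ c ⟧ ≤ ⟦ b ∧ c ⟧
⟦∧⟧-monoˡ {false} c _ = z≤n
⟦∧⟧-monoˡ {true} c a⇒b rewrite a⇒b refl = ≤-refl

⟦∨⟧≤ : ∀ a b → ⟦ a ∨ b ⟧ ≤ ⟦ a ⟧ + ⟦ b ⟧
⟦∨⟧≤ false b = ≤-refl
⟦∨⟧≤ true b = s≤s z≤n

∑ : {A : Set} → List A → (A → ℕ) → ℕ
∑ [] f = 0
∑ (x ∷ xs) f = f x + ∑ xs f

syntax ∑ xs (λ x → e) = ∑[ x ∈ xs ] e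

private variable A : Set

∑-mono-≤ : ∀ xs {f g : A → ℕ} → (∀ x → f x ≤ g x) → ∑ xs f ≤ ∑ xs g
∑-mono-≤ [] _ = z≤n
∑-mono-≤ (x ∷ xs) f≤g = +-mono-≤ (f≤g x) (∑-mono-≤ xs f≤g)

∑-mono-< : ∀ {xs a} {f g : A → ℕ} → (∀ x → f x ≤ g x) → a ∈ xs → f a < g a → ∑ xs f < ∑ xs g
∑-mono-< {xs = _ ∷ xs} f≤g (here refl) fa<ga = +-mono-<-≤ fa<ga (∑-mono-≤ xs f≤g)
∑-mono-< {xs = x ∷ _} f≤g (there a∈xs) fa<ga = +-mono-≤-< (f≤g x) (∑-mono-< f≤g a∈xs fa<ga)

∑-≥-term : ∀ {xs a} (f : A → ℕ) → a ∈ xs → f a ≤ ∑ xs f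
∑-≥-term {xs = _ ∷ xs} f (here refl) = m≤m+n _ (∑ xs f)
∑-≥-term {xs = x ∷ _} f (there a∈xs) = ≤-trans (∑-≥-term f a∈xs) (m≤n+m _ (f x))

∑-≡0 : ∀ {xs} {f : A → ℕ} → All (λ x → f x ≡ 0) xs → ∑ xs f ≡ 0
∑-≡0 All.[] = refl
∑-≡0 (fx≡0 All.∷ rest) rewrite fx≡0 = ∑-≡0 rest

∑-+ : ∀ xs (f g : A → ℕ) → ∑[ x ∈ xs ] (f x + g x) ≡ ∑ xs f + ∑ xs g
∑-+ [] f g = refl
∑-+ (x ∷ xs) f g rewrite ∑-+ xs f g = swap (f x) (g x) (∑ xs f) (∑ xs g)
  where
  swap : ∀ a b c d → a + b + (c + d) ≡ a + c + (b + d)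
  swap = solve-∀

∑-*ˡ : ∀ xs k (f : A → ℕ) → ∑[ x ∈ xs ] (k * f x) ≡ k * ∑ xs f
∑-*ˡ [] k f = sym (*-zeroʳ k)
∑-*ˡ (x ∷ xs) k f rewrite ∑-*ˡ xs k f = sym (*-distribˡ-+ k (f x) (∑ xs f))

length-filter-T? : ∀ (b : A → Bool) xs → length (filter (λ x → T? (b x)) xs) ≡ ∑[ x ∈ xs ] ⟦ b x ⟧
length-filter-T? b [] = refl
length-filter-T? b (x ∷ xs) with b x
... | true = cong suc (length-filter-T? b xs)
... | false = length-filter-T? b xs

module _ {A B : Set} (_≟_ : DecidableEquality B) {f : A → B} (f-injective : Injective _≡_ _≡_ f) where

  ∑-≟-≤1 : ∀ {xs} → Unique xs → ∀ b → ∑[ x ∈ xs ] ⟦ does (f x ≟ b) ⟧ ≤ 1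
  ∑-≟-≤1 [] b = z≤n
  ∑-≟-≤1 {x ∷ _} (x∉xs ∷ xs-unique) b with f x ≟ b
  ... | no _ = ∑-≟-≤1 xs-unique b
  ... | yes refl = s≤s (≤-reflexive (∑-≡0 (All.map missed x∉xs)))
    where
    missed : ∀ {y} → x ≢ y → ⟦ does (f y ≟ f x) ⟧ ≡ 0
    missed x≢y = cong ⟦_⟧ (dec-false (f _ ≟ f x) (λ fy≡fx → x≢y (f-injective (sym fy≡fx))))

  ∑-≤-length : ∀ {xs} → Unique xs → ∀ (ps : List B) (b : A → Bool) → (∀ x → b x ≡ true → f x ∈ ps) →
               ∑[ x ∈ xs ] ⟦ b x ⟧ ≤ length ps
  ∑-≤-length {xs} xs-unique ps b into = ≤-trans (∑-mono-≤ xs hit) (hits≤ ps)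
    where
    hit : ∀ x → ⟦ b x ⟧ ≤ ∑[ p ∈ ps ] ⟦ does (f x ≟ p) ⟧
    hit x with b x in bx
    ... | false = z≤n
    ... | true = ≤-trans (≤-reflexive (cong ⟦_⟧ (sym (dec-true (f x ≟ f x) refl))))
                   (∑-≥-term (λ p → ⟦ does (f x ≟ p) ⟧) (into x bx))
    hits≤ : ∀ qs → ∑[ x ∈ xs ] ∑[ p ∈ qs ] ⟦ does (f x ≟ p) ⟧ ≤ length qs
    hits≤ [] = ≤-reflexive (∑-≡0 (All.universal (λ _ → refl) xs))
    hits≤ (q ∷ qs) = begin
      ∑[ x ∈ xs ] (⟦ does (f x ≟ q) ⟧ + ∑[ p ∈ qs ] ⟦ does (f x ≟ p) ⟧)
        ≡⟨ ∑-+ xs _ _ ⟩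
      ∑[ x ∈ xs ] ⟦ does (f x ≟ q) ⟧ + ∑[ x ∈ xs ] ∑[ p ∈ qs ] ⟦ does (f x ≟ p) ⟧
        ≤⟨ +-mono-≤ (∑-≟-≤1 xs-unique q) (hits≤ qs) ⟩
      suc (length qs) ∎
      where open ≤-Reasoning

module FiniteGraph {V : Set} (_≟_ : DecidableEquality V)
                   (vs : List V) (∈-vs : ∀ v → v ∈ vs) (vs-unique : Unique vs)
                   (_~?_ : V → V → Bool) (~?-sym : ∀ u v → u ~? v ≡ v ~? u) where

  Subset : Set
  Subset = V → Bool

  private variable
    P Q R : Subset
    t u v x : V

  _⊆_ : Subset → Subset → Set
  P ⊆ Q = ∀ v → P v ≡ true → Q v ≡ true

  ∅ : Subset
  ∅ _ = false

  insert : V → Subset → Subset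
  insert x P v = does (v ≟ x) ∨ P v

  _∖_ : Subset → Subset → Subset
  (P ∖ Q) v = P v ∧ not (Q v)

  ∣_∣ : Subset → ℕ
  ∣ P ∣ = ∑[ v ∈ vs ] ⟦ P v ⟧

  degree : Subset → V → ℕ
  degree P v = length (filter (λ w → T? (P w ∧ v ~? w)) vs)

  countDegree : Subset → ℕ → ℕ
  countDegree P k = length (filter (λ v → T? (P v ∧ (degree P v ≡ᵇ k))) vs)

  memberDegree : Subset → V → ℕ
  memberDegree P v = ⟦ P v ⟧ * degree P v

  degreeSum : Subset → ℕ
  degreeSum P = ∑ vs (memberDegree P)

  data CrossingEdge (P Q : Subset) : Set where
    crossingEdge : Q u ≡ true → (P ∖ Q) x ≡ true → u ~? x ≡ true → CrossingEdge P Q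

  CutConnected : Subset → Set
  CutConnected P = ∀ Q → Q ⊆ P → ∀ {t x} → Q t ≡ true → (P ∖ Q) x ≡ true → CrossingEdge P Q

  EdgeBound : Subset → Set
  EdgeBound P = 2 * ∣ P ∣ ≤ degreeSum P + 2

  insert-⊇ : P ⊆ insert x P
  insert-⊇ {x = x} v Pv rewrite Pv = ∨-zeroʳ (does (v ≟ x))

  x∈insert : insert x P x ≡ true
  x∈insert {x = x} rewrite dec-true (x ≟ x) refl = refl

  insert-⊆ : P ⊆ R → R x ≡ true → insert x P ⊆ R
  insert-⊆ {x = x} P⊆R Rx v v∈ with v ≟ x
  ... | yes refl = Rx
  ... | no _ = P⊆R v v∈

  ∖-intro : R v ≡ true → P v ≡ false → (R ∖ P) v ≡ true
  ∖-intro Rv Pv rewrite Rv | Pv = refl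

  ∖-elim : (R ∖ P) v ≡ true → R v ≡ true × P v ≡ false
  ∖-elim {R} {P} {v} v∈ with R v | P v
  ... | true | false = refl , refl

  ∖-∉ : P v ≡ true → (R ∖ P) v ≡ false
  ∖-∉ {P} {v} {R} Pv rewrite Pv with R v
  ... | true = refl
  ... | false = refl

  ∖-antimono : P ⊆ Q → (R ∖ Q) ⊆ (R ∖ P)
  ∖-antimono {P} {Q} {R} P⊆Q v v∈ with ∖-elim {R} {Q} v∈ | P v in Pv
  ... | Rv , _ | false rewrite Rv = refl
  ... | _ , Qv | true with trans (sym (P⊆Q v Pv)) Qv
  ...   | ()

  ∖≡false⇒ : (R ∖ P) v ≡ false → R v ≡ true → P v ≡ true
  ∖≡false⇒ {R} {P} {v} v∉ Rv with R v | P v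
  ∖≡false⇒ () _ | true | false
  ... | true | true = refl

  empty-or-inhabited : ∀ (P : Subset) → (∀ v → P v ≡ false) ⊎ Σ V (λ v → P v ≡ true)
  empty-or-inhabited P with any? (λ v → P v Bool.≟ true) vs
  ... | yes inhabited = inj₂ (satisfied inhabited)
  ... | no empty = inj₁ λ v → ¬-not (λ Pv → empty (lose (∈-vs v) Pv))

  ∣∣-mono : P ⊆ Q → ∣ P ∣ ≤ ∣ Q ∣
  ∣∣-mono P⊆Q = ∑-mono-≤ vs (λ v → ⟦⟧-mono (P⊆Q v))

  ∣∣-mono-< : P ⊆ Q → P x ≡ false → Q x ≡ true → ∣ P ∣ < ∣ Q ∣
  ∣∣-mono-< {P} {Q} {x} P⊆Q Px Qx = ∑-mono-< (λ v → ⟦⟧-mono (P⊆Q v)) (∈-vs x) grows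
    where
    grows : ⟦ P x ⟧ < ⟦ Q x ⟧
    grows rewrite Px | Qx = s≤s z≤n

  ∣∣-empty : (∀ v → P v ≡ false) → ∣ P ∣ ≡ 0
  ∣∣-empty empty = ∑-≡0 (All.universal (λ v → cong ⟦_⟧ (empty v)) vs)

  ∣insert∣≤ : ∣ insert x P ∣ ≤ suc ∣ P ∣
  ∣insert∣≤ {x} {P} = begin
    ∑[ v ∈ vs ] ⟦ does (v ≟ x) ∨ P v ⟧                   ≤⟨ ∑-mono-≤ vs (λ v → ⟦∨⟧≤ (does (v ≟ x)) (P v)) ⟩
    ∑[ v ∈ vs ] (⟦ does (v ≟ x) ⟧ + ⟦ P v ⟧)             ≡⟨ ∑-+ vs _ _ ⟩
    ∑[ v ∈ vs ] ⟦ does (v ≟ x) ⟧ + ∣ P ∣                 ≤⟨ +-monoˡ-≤ ∣ P ∣ (∑-≟-≤1 _≟_ (λ e → e) vs-unique x) ⟩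
    suc ∣ P ∣                                             ∎
    where open ≤-Reasoning

  degree-∑ : degree P v ≡ ∑[ w ∈ vs ] ⟦ P w ∧ v ~? w ⟧
  degree-∑ {P} {v} = length-filter-T? (λ w → P w ∧ v ~? w) vs

  degree-mono : P ⊆ Q → degree P v ≤ degree Q v
  degree-mono {P} {Q} {v} P⊆Q = begin
    degree P v                       ≡⟨ degree-∑ ⟩
    ∑[ w ∈ vs ] ⟦ P w ∧ v ~? w ⟧     ≤⟨ ∑-mono-≤ vs (λ w → ⟦∧⟧-monoˡ (v ~? w) (P⊆Q w)) ⟩
    ∑[ w ∈ vs ] ⟦ Q w ∧ v ~? w ⟧     ≡⟨ degree-∑ ⟨
    degree Q v                       ∎
    where open ≤-Reasoning

  degree-pos : P u ≡ true → v ~? u ≡ true → 0 < degree P v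
  degree-pos {P} {u} {v} Pu v~u = begin-strict
    0                                <⟨ s≤s z≤n ⟩
    ⟦ true ∧ true ⟧                  ≡⟨ cong₂ (λ a b → ⟦ a ∧ b ⟧) Pu v~u ⟨
    ⟦ P u ∧ v ~? u ⟧                 ≤⟨ ∑-≥-term (λ w → ⟦ P w ∧ v ~? w ⟧) (∈-vs u) ⟩
    ∑[ w ∈ vs ] ⟦ P w ∧ v ~? w ⟧     ≡⟨ degree-∑ ⟨
    degree P v                       ∎
    where open ≤-Reasoning

  degree-insert : P x ≡ false → v ~? x ≡ true → degree P v < degree (insert x P) v
  degree-insert {P} {x} {v} Px v~x = begin-strict
    degree P v                                ≡⟨ degree-∑ ⟩
    ∑[ w ∈ vs ] ⟦ P w ∧ v ~? w ⟧              <⟨ ∑-mono-< (λ w → ⟦∧⟧-monoˡ (v ~? w) (insert-⊇ {P} {x} w)) (∈-vs x) gain ⟩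
    ∑[ w ∈ vs ] ⟦ insert x P w ∧ v ~? w ⟧     ≡⟨ degree-∑ ⟨
    degree (insert x P) v                     ∎
    where
    open ≤-Reasoning
    gain : ⟦ P x ∧ v ~? x ⟧ < ⟦ insert x P x ∧ v ~? x ⟧
    gain rewrite dec-true (x ≟ x) refl | Px | v~x = s≤s z≤n

  memberDegree-∈ : P v ≡ true → memberDegree P v ≡ degree P v
  memberDegree-∈ {P} {v} Pv rewrite Pv = +-identityʳ (degree P v)

  memberDegree-mono : P ⊆ Q → memberDegree P v ≤ memberDegree Q v
  memberDegree-mono {v = v} P⊆Q = *-mono-≤ (⟦⟧-mono (P⊆Q v)) (degree-mono P⊆Q)

  degreeSum-mono : P ⊆ Q → degreeSum P ≤ degreeSum Q
  degreeSum-mono P⊆Q = ∑-mono-≤ vs (λ v → memberDegree-mono P⊆Q)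

  degreeSum-insert : P u ≡ true → P x ≡ false → u ~? x ≡ true → 2 + degreeSum P ≤ degreeSum (insert x P)
  -- The edge u x raises the degree of u by one and gives x a positive degree; marking u
  -- separates the two gains into two strict steps.
  degreeSum-insert {P} {u} {x} Pu Px u~x = ≤-trans (s≤s marked-u) marked-x
    where
    P′ = insert x P
    marked : V → ℕ
    marked v = memberDegree P v + ⟦ does (v ≟ u) ⟧
    marked-u : degreeSum P < ∑ vs marked
    marked-u = ∑-mono-< (λ v → m≤m+n _ _) (∈-vs u)
                 (m<m+n _ (≤-reflexive (cong ⟦_⟧ (sym (dec-true (u ≟ u) refl)))))
    marked≤ : ∀ v → marked v ≤ memberDegree P′ v
    marked≤ v with v ≟ u
    ... | yes refl = begin
      memberDegree P v + 1  ≡⟨ cong (_+ 1) (memberDegree-∈ Pu) ⟩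
      degree P v + 1        ≡⟨ +-comm (degree P v) 1 ⟩
      suc (degree P v)      ≤⟨ degree-insert Px u~x ⟩
      degree P′ v           ≡⟨ memberDegree-∈ (insert-⊇ {P} {x} v Pu) ⟨
      memberDegree P′ v     ∎
      where open ≤-Reasoning
    ... | no _ = ≤-trans (≤-reflexive (+-identityʳ (memberDegree P v))) (memberDegree-mono (insert-⊇ {P} {x}))
    marked-x : ∑ vs marked < degreeSum P′
    marked-x = ∑-mono-< marked≤ (∈-vs x) gain
      where
      x≢u : x ≢ u
      x≢u refl with trans (sym Pu) Px
      ... | ()
      gain : marked x < memberDegree P′ x
      gain = begin-strict
        marked x       ≡⟨ cong₂ (λ a b → ⟦ a ⟧ * degree P x + ⟦ b ⟧) Px (dec-false (x ≟ u) x≢u) ⟩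
        0              <⟨ degree-pos (insert-⊇ {P} {x} u Pu) (trans (~?-sym x u) u~x) ⟩
        degree P′ x    ≡⟨ memberDegree-∈ (x∈insert {x} {P}) ⟨
        memberDegree P′ x ∎
        where open ≤-Reasoning

  edgeBound-singleton : EdgeBound (insert t ∅)
  edgeBound-singleton {t} = begin
    2 * ∣ insert t ∅ ∣     ≤⟨ *-monoʳ-≤ 2 ∣insert∣≤ ⟩
    2 * suc ∣ ∅ ∣          ≡⟨ cong (λ k → 2 * suc k) (∣∣-empty {∅} λ _ → refl) ⟩
    2                      ≤⟨ m≤n+m 2 _ ⟩
    degreeSum (insert t ∅) + 2 ∎
    where open ≤-Reasoning

  edgeBound-insert : P u ≡ true → P x ≡ false → u ~? x ≡ true → EdgeBound P → EdgeBound (insert x P)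
  edgeBound-insert {P} {u} {x} Pu Px u~x bound = begin
    2 * ∣ insert x P ∣              ≤⟨ *-monoʳ-≤ 2 ∣insert∣≤ ⟩
    2 * suc ∣ P ∣                   ≡⟨ *-suc 2 ∣ P ∣ ⟩
    2 + 2 * ∣ P ∣                   ≤⟨ +-monoʳ-≤ 2 bound ⟩
    2 + (degreeSum P + 2)           ≡⟨ +-assoc 2 (degreeSum P) 2 ⟨
    2 + degreeSum P + 2             ≤⟨ +-monoˡ-≤ 2 (degreeSum-insert Pu Px u~x) ⟩
    degreeSum (insert x P) + 2      ∎
    where open ≤-Reasoning

  edgeBound-grow : CutConnected R → ∀ k → ∣ R ∖ P ∣ < k → P ⊆ R → P t ≡ true → EdgeBound P → EdgeBound R
  edgeBound-grow _ zero ()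
  edgeBound-grow {R} {P} connected (suc k) shrink P⊆R Pt bound with empty-or-inhabited (R ∖ P)
  ... | inj₁ R∖P-empty = begin
    2 * ∣ R ∣                ≤⟨ *-monoʳ-≤ 2 (∣∣-mono (λ v → ∖≡false⇒ {R} {P} (R∖P-empty v))) ⟩
    2 * ∣ P ∣                ≤⟨ bound ⟩
    degreeSum P + 2          ≤⟨ +-monoˡ-≤ 2 (degreeSum-mono P⊆R) ⟩
    degreeSum R + 2          ∎
    where open ≤-Reasoning
  ... | inj₂ (_ , s∈R∖P) with connected P P⊆R Pt s∈R∖P
  ... | crossingEdge {u} {x} Pu x∈R∖P u~x with ∖-elim {R} {P} x∈R∖P
  ... | Rx , Px = edgeBound-grow connected k shrinks (insert-⊆ P⊆R Rx) (insert-⊇ {P} {x} _ Pt)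
                    (edgeBound-insert Pu Px u~x bound)
    where
    shrinks : ∣ R ∖ insert x P ∣ < k
    shrinks = <-≤-trans (∣∣-mono-< (∖-antimono (insert-⊇ {P} {x})) (∖-∉ {insert x P} {x} {R} (x∈insert {x} {P})) x∈R∖P)
                        (s≤s⁻¹ shrink)

  connected⇒edgeBound : CutConnected R → EdgeBound R
  connected⇒edgeBound {R} connected with empty-or-inhabited R
  ... | inj₁ R-empty = subst (λ k → 2 * k ≤ degreeSum R + 2) (sym (∣∣-empty R-empty)) z≤n
  ... | inj₂ (t , Rt) = edgeBound-grow connected _ (n<1+n _) (insert-⊆ {∅} (λ _ ()) Rt) (x∈insert {t} {∅})
                          edgeBound-singleton

  degree-tally : ∀ r d → d ≤ 4 →
    ⟦ r ∧ (d ≡ᵇ 1) ⟧ + ⟦ r ⟧ * d ≤ 2 * ⟦ r ⟧ + (⟦ r ∧ (d ≡ᵇ 3) ⟧ + 2 * ⟦ r ∧ (d ≡ᵇ 4) ⟧)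
  degree-tally false d _ = z≤n
  degree-tally true 0 _ = z≤n
  degree-tally true 1 _ = ≤-refl
  degree-tally true 2 _ = ≤-refl
  degree-tally true 3 _ = ≤-refl
  degree-tally true 4 _ = ≤-refl
  degree-tally true (suc (suc (suc (suc (suc _))))) (s≤s (s≤s (s≤s (s≤s ()))))

  leaves-bound : CutConnected R → (∀ v → degree R v ≤ 4) →
                 countDegree R 1 ≤ countDegree R 3 + 2 * countDegree R 4 + 2
  leaves-bound {R} connected degree≤4 = +-cancelˡ-≤ (degreeSum R) _ _ (begin
    degreeSum R + c 1
      ≡⟨ cong (degreeSum R +_) (c-∑ 1) ⟩
    degreeSum R + ∑ vs (indicator 1)
      ≡⟨ +-comm (degreeSum R) _ ⟩
    ∑ vs (indicator 1) + degreeSum R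
      ≡⟨ ∑-+ vs _ _ ⟨
    ∑[ v ∈ vs ] (indicator 1 v + ⟦ R v ⟧ * degree R v)
      ≤⟨ ∑-mono-≤ vs (λ v → degree-tally (R v) (degree R v) (degree≤4 v)) ⟩
    ∑[ v ∈ vs ] (2 * ⟦ R v ⟧ + (indicator 3 v + 2 * indicator 4 v))
      ≡⟨ ∑-+ vs _ _ ⟩
    ∑[ v ∈ vs ] (2 * ⟦ R v ⟧) + ∑[ v ∈ vs ] (indicator 3 v + 2 * indicator 4 v)
      ≡⟨ cong₂ _+_ (∑-*ˡ vs 2 _) (∑-+ vs _ _) ⟩
    2 * ∣ R ∣ + (∑ vs (indicator 3) + ∑[ v ∈ vs ] (2 * indicator 4 v))
      ≡⟨ cong (λ k → 2 * ∣ R ∣ + (∑ vs (indicator 3) + k)) (∑-*ˡ vs 2 _) ⟩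
    2 * ∣ R ∣ + (∑ vs (indicator 3) + 2 * ∑ vs (indicator 4))
      ≡⟨ cong₂ (λ a b → 2 * ∣ R ∣ + (a + 2 * b)) (c-∑ 3) (c-∑ 4) ⟨
    2 * ∣ R ∣ + (c 3 + 2 * c 4)
      ≤⟨ +-monoˡ-≤ _ (connected⇒edgeBound connected) ⟩
    degreeSum R + 2 + (c 3 + 2 * c 4)
      ≡⟨ rearrange (degreeSum R) (c 3) (c 4) ⟩
    degreeSum R + (c 3 + 2 * c 4 + 2) ∎)
    where
    open ≤-Reasoning
    c : ℕ → ℕ
    c = countDegree R
    indicator : ℕ → V → ℕ
    indicator k v = ⟦ R v ∧ (degree R v ≡ᵇ k) ⟧
    c-∑ : ∀ k → c k ≡ ∑ vs (indicator k)
    c-∑ k = length-filter-T? (λ v → R v ∧ (degree R v ≡ᵇ k)) vs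
    rearrange : ∀ a b c → a + 2 + (b + 2 * c) ≡ a + (b + 2 * c + 2)
    rearrange = solve-∀

∣m-n∣≡1⇒ : ∀ a c → ∣ a - c ∣ ≡ 1 → c ≡ suc a ⊎ a ≡ suc c
∣m-n∣≡1⇒ zero c e = inj₁ e
∣m-n∣≡1⇒ (suc a) zero e = inj₂ e
∣m-n∣≡1⇒ (suc a) (suc c) e with ∣m-n∣≡1⇒ a c e
... | inj₁ c≡1+a = inj₁ (cong suc c≡1+a)
... | inj₂ a≡1+c = inj₂ (cong suc a≡1+c)

m+n≡1⇒ : ∀ a b → a + b ≡ 1 → (a ≡ 0 × b ≡ 1) ⊎ (a ≡ 1 × b ≡ 0)
m+n≡1⇒ zero b e = inj₁ (refl , e)
m+n≡1⇒ (suc zero) zero e = inj₂ (refl , refl)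

module _ {n m : ℕ} where

  _≟ᵥ_ : DecidableEquality (Vertex n m)
  _≟ᵥ_ = ≡-dec Fin._≟_ Fin._≟_

  ∈-vertices : ∀ v → v ∈ vertices n m
  ∈-vertices (i , j) = ∈-cartesianProduct⁺ (∈-allFin i) (∈-allFin j)

  vertices-unique : Unique (vertices n m)
  vertices-unique = cartesianProduct⁺ (allFin⁺ n) (allFin⁺ m)

  dist-sym : ∀ (u v : Vertex n m) → dist u v ≡ dist v u
  dist-sym (i , j) (k , l) = cong₂ _+_ (∣-∣-comm (toℕ i) (toℕ k)) (∣-∣-comm (toℕ j) (toℕ l))

  adj?-sym : ∀ (u v : Vertex n m) → adj? u v ≡ adj? v u
  adj?-sym u v = cong (_≡ᵇ 1) (dist-sym u v)

  Adj⇒adj? : ∀ {u v : Vertex n m} → Adj u v → adj? u v ≡ true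
  Adj⇒adj? {u} {v} e = Equivalence.to T-≡ (≡⇒≡ᵇ (dist u v) 1 e)

  adj?⇒Adj : ∀ {u v : Vertex n m} → adj? u v ≡ true → Adj u v
  adj?⇒Adj {u} {v} e = ≡ᵇ⇒≡ (dist u v) 1 (Equivalence.from T-≡ e)

  coordinates : Vertex n m → ℕ × ℕ
  coordinates (i , j) = toℕ i , toℕ j

  coordinates-injective : Injective _≡_ _≡_ coordinates
  coordinates-injective {i , j} {k , l} e =
    cong₂ _,_ (toℕ-injective (cong proj₁ e)) (toℕ-injective (cong proj₂ e))

  -- At the border, truncated subtraction makes some candidates junk; only their number matters.
  neighbourCandidates : Vertex n m → List (ℕ × ℕ)
  neighbourCandidates (i , j) =
    (suc (toℕ i) , toℕ j) ∷ (toℕ i ∸ 1 , toℕ j) ∷ (toℕ i , suc (toℕ j)) ∷ (toℕ i , toℕ j ∸ 1) ∷ []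

  Adj⇒neighbourCandidate : ∀ {v w : Vertex n m} → Adj v w → coordinates w ∈ neighbourCandidates v
  Adj⇒neighbourCandidate {i , j} {k , l} adj with m+n≡1⇒ ∣ toℕ i - toℕ k ∣ ∣ toℕ j - toℕ l ∣ adj
  ... | inj₁ (di≡0 , dj≡1) with ∣m-n∣≡0⇒m≡n di≡0 | ∣m-n∣≡1⇒ (toℕ j) (toℕ l) dj≡1
  ...   | i≡k | inj₁ l≡1+j = there (there (here (cong₂ _,_ (sym i≡k) l≡1+j)))
  ...   | i≡k | inj₂ j≡1+l = there (there (there (here (cong₂ _,_ (sym i≡k) (sym (cong (_∸ 1) j≡1+l))))))
  Adj⇒neighbourCandidate {i , j} {k , l} adj | inj₂ (di≡1 , dj≡0)
    with ∣m-n∣≡1⇒ (toℕ i) (toℕ k) di≡1 | ∣m-n∣≡0⇒m≡n dj≡0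
  ...   | inj₁ k≡1+i | j≡l = here (cong₂ _,_ k≡1+i (sym j≡l))
  ...   | inj₂ i≡1+k | j≡l = there (here (cong₂ _,_ (sym (cong (_∸ 1) i≡1+k)) (sym j≡l)))

  walk-start : ∀ {S : VSet n m} {u v} → WalkIn S u v → S u ≡ true
  walk-start (here u∈S) = Equivalence.to T-≡ u∈S
  walk-start (step u∈S _ _) = Equivalence.to T-≡ u∈S

module GridGraph (n m : ℕ) where
  open FiniteGraph {Vertex n m} _≟ᵥ_ (vertices n m) ∈-vertices vertices-unique adj? adj?-sym public

  degree≤4 : ∀ P v → degree P v ≤ 4
  degree≤4 P v = begin
    degree P v                          ≡⟨ degree-∑ {P} {v} ⟩
    ∑[ w ∈ vertices n m ] ⟦ P w ∧ adj? v w ⟧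
      ≤⟨ ∑-≤-length (≡-dec ℕ._≟_ ℕ._≟_) coordinates-injective vertices-unique
           (neighbourCandidates v) _ (λ w e → Adj⇒neighbourCandidate (adj?⇒Adj {u = v} {v = w} (∧-elimʳ (P w) e))) ⟩
    4                                   ∎
    where
    open ≤-Reasoning
    ∧-elimʳ : ∀ a {b} → a ∧ b ≡ true → b ≡ true
    ∧-elimʳ true e = e

  walk⇒crossingEdge : ∀ {S Q : Subset} {t s} → WalkIn S t s → Q t ≡ true → Q s ≡ false → CrossingEdge S Q
  walk⇒crossingEdge (here _) Qt Qs with trans (sym Qt) Qs
  ... | ()
  walk⇒crossingEdge {S} {Q} (step {u} {w} _ u~w walk) Qu Qs with Q w in Qw
  ... | true = walk⇒crossingEdge walk Qw Qs
  ... | false = crossingEdge Qu (∖-intro {S} {w} {Q} (walk-start walk) Qw) (Adj⇒adj? {u = u} {v = w} u~w)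

  connected⇒cutConnected : ∀ {S} → Connected S → CutConnected S
  connected⇒cutConnected {S} connected Q Q⊆S {t} {s} Qt s∈S∖Q with ∖-elim {S} {Q} s∈S∖Q
  ... | Ss , Qs = walk⇒crossingEdge (connected t s (Equivalence.from T-≡ (Q⊆S t Qt)) (Equivalence.from T-≡ Ss)) Qt Qs

lemma1 : ∀ (n m : ℕ) (S : VSet n m) → ConnectedDominatingSet S →
         countDeg S 1 ≤ countDeg S 3 + 2 * countDeg S 4 + 2
lemma1 n m S (connected , _) = leaves-bound (connected⇒cutConnected connected) (degree≤4 S)
  where open GridGraph n m
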